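{- Let $A$ be a bounded distributive lattice. Then $A$ is a Heyting algebra if and only if the frame $\mathcal{J}(A)$ of ideals of $A$ is a Heyting frame.
   Context: $\mathcal{J}(A)$ is the frame of ideals of $A$ ordered by inclusion. For a frame $L$, $K(L)$ denotes the set of compact elements of $L$ (elements $a$ such that $a\le\bigvee S$ implies $a\le\bigvee T$ for some finite $T\subseteq S$). A frame $L$ is a Heyting frame if $K(L)$ is a Heyting subalgebra of $L$: it contains $0,1$ and is closed under finite meets, finite joins, and the Heyting implication of the frame $L$. -}

module Defs where

open import Level using (Level; _⊔_; suc; Lift; lift)
open import Data.Product using (Σ; _×_; _,_; proj₁; proj₂)
open import Data.List using (List; []; _∷_; _++_; map; foldr)
open import Data.Bool using (Bool; true; false)
open import Data.Unit using (⊤; tt)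
open import Algebra.Core using (Op₂)
open import Relation.Binary.Core using (Rel)
open import Relation.Binary.Definitions using (Maximum; Minimum)
open import Relation.Binary.Lattice.Definitions using (Exponential)
open import Relation.Binary.Lattice.Structures using (IsDistributiveLattice)
open import Relation.Binary.Lattice.Bundles using (DistributiveLattice)
import Relation.Binary.Lattice.Properties.JoinSemilattice as JSP
import Relation.Binary.Lattice.Properties.MeetSemilattice as MSP
import Relation.Binary.Lattice.Properties.DistributiveLattice as DLP

record BoundedDistributiveLattice c ℓ₁ ℓ₂ : Set (suc (c ⊔ ℓ₁ ⊔ ℓ₂)) where
  infix  4 _≈_ _≤_
  infixr 6 _∨_
  infixr 7 _∧_
  field
    Carrier : Set c
    _≈_     : Rel Carrier ℓ₁
    _≤_     : Rel Carrier ℓ₂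
    _∨_     : Op₂ Carrier
    _∧_     : Op₂ Carrier
    ⊤ᴬ      : Carrier
    ⊥ᴬ      : Carrier
    isDistributiveLattice : IsDistributiveLattice _≈_ _≤_ _∨_ _∧_
    maximum : Maximum _≤_ ⊤ᴬ
    minimum : Minimum _≤_ ⊥ᴬ

  distributiveLattice : DistributiveLattice c ℓ₁ ℓ₂
  distributiveLattice = record { isDistributiveLattice = isDistributiveLattice }

  open DistributiveLattice distributiveLattice public
    using (x≤x∨y; y≤x∨y; ∨-least; x∧y≤x; x∧y≤y; ∧-greatest;
           joinSemilattice; meetSemilattice; reflexive; trans; refl)

-- A bounded distributive lattice is a Heyting algebra iff it carries a
-- relative pseudocomplement (exponential) operation  a ⇨ b  with
--   w ∧ x ≤ y  ⇔  w ≤ x ⇨ y   (stdlib's Exponential).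

IsHeytingAlgebra : ∀ {c ℓ₁ ℓ₂} → BoundedDistributiveLattice c ℓ₁ ℓ₂ → Set (c ⊔ ℓ₂)
IsHeytingAlgebra A = Σ (Op₂ Carrier) (λ _⇨_ → Exponential _≤_ _∧_ _⇨_)
  where open BoundedDistributiveLattice A

module IdealFrame {c ℓ₁ ℓ₂} (A : BoundedDistributiveLattice c ℓ₁ ℓ₂) where
  open BoundedDistributiveLattice A
  open JSP joinSemilattice using (∨-monotonic)
  open MSP meetSemilattice using (∧-monotonic)
  open DLP distributiveLattice using (∧-distribʳ-∨)

  ℓ : Level
  ℓ = c ⊔ ℓ₂

  record Ideal : Set (suc ℓ) where
    field
      mem      : Carrier → Set ℓ
      down     : ∀ {x y} → x ≤ y → mem y → mem x
      has⊥     : mem ⊥ᴬ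
      ∨-closed : ∀ {x y} → mem x → mem y → mem (x ∨ y)
  open Ideal public

  infix 4 _⊆_
  _⊆_ : Ideal → Ideal → Set ℓ
  I ⊆ J = ∀ {x} → mem I x → mem J x

  bigJoin : List Carrier → Carrier
  bigJoin = foldr _∨_ ⊥ᴬ

  private
    ⊥≤ : ∀ {x} → ⊥ᴬ ≤ x
    ⊥≤ {x} = minimum x

    ≤++ˡ : ∀ ys zs → bigJoin ys ≤ bigJoin (ys ++ zs)
    ≤++ˡ [] zs = ⊥≤
    ≤++ˡ (y ∷ ys) zs = ∨-monotonic refl (≤++ˡ ys zs)

    ≤++ʳ : ∀ ys zs → bigJoin zs ≤ bigJoin (ys ++ zs)
    ≤++ʳ [] zs = refl
    ≤++ʳ (y ∷ ys) zs = trans (≤++ʳ ys zs) (y≤x∨y y _)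


  open import Relation.Binary.PropositionalEquality using (subst; sym)
  open import Data.List.Properties using (map-++)

  -- Arbitrary joins in J(A), for families indexed by a type Ix : Set ℓ:
  -- x ∈ ⋁ S  iff  x ≤ y₁ ∨ … ∨ yₙ for finitely many yₖ ∈ S iₖ.
  ⋁ : {Ix : Set ℓ} → (Ix → Ideal) → Ideal
  ⋁ {Ix} S = record
    { mem = λ x → Σ (List (Σ Ix (λ i → Σ Carrier (mem (S i)))))
                    (λ ys → x ≤ bigJoin (map el ys))
    ; down = λ { x≤y (ys , y≤) → ys , trans x≤y y≤ }
    ; has⊥ = [] , refl
    ; ∨-closed = λ { {x} {y} (ys , x≤) (zs , y≤) → ys ++ zs ,
        subst (λ l → x ∨ y ≤ bigJoin l) (sym (map-++ el ys zs))
          (∨-least (trans x≤ (≤++ˡ (map el ys) (map el zs)))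
                   (trans y≤ (≤++ʳ (map el ys) (map el zs)))) }
    }
    where
      el : Σ Ix (λ i → Σ Carrier (mem (S i))) → Carrier
      el p = proj₁ (proj₂ p)

  ⊥I : Ideal
  ⊥I = record
    { mem = λ x → Lift ℓ (x ≤ ⊥ᴬ)
    ; down = λ { x≤y (lift y≤⊥) → lift (trans x≤y y≤⊥) }
    ; has⊥ = lift refl
    ; ∨-closed = λ { (lift p) (lift q) → lift (∨-least p q) }
    }

  ⊤I : Ideal
  ⊤I = record
    { mem = λ _ → Lift ℓ ⊤
    ; down = λ _ _ → lift tt
    ; has⊥ = lift tt
    ; ∨-closed = λ _ _ → lift tt
    }

  _∩_ : Ideal → Ideal → Ideal
  I ∩ J = record
    { mem = λ x → mem I x × mem J x
    ; down = λ { x≤y (p , q) → down I x≤y p , down J x≤y q }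
    ; has⊥ = has⊥ I , has⊥ J
    ; ∨-closed = λ { (p , q) (p' , q') → ∨-closed I p p' , ∨-closed J q q' }
    }

  _⊔I_ : Ideal → Ideal → Ideal
  I ⊔I J = ⋁ {Lift ℓ Bool} (λ { (lift true) → I ; (lift false) → J })

  ⋁fin : List Ideal → Ideal
  ⋁fin = foldr _⊔I_ ⊥I

  -- the Heyting implication of the frame J(A):
  -- I ⇒ J = ⋁ { X | X ∩ I ⊆ J } = { x | ∀ y ∈ I, x ∧ y ∈ J }
  _⇒I_ : Ideal → Ideal → Ideal
  I ⇒I J = record
    { mem = λ x → ∀ y → mem I y → mem J (x ∧ y)
    ; down = λ x≤x' h y y∈I → down J (∧-monotonic x≤x' refl) (h y y∈I)
    ; has⊥ = λ y _ → down J (x∧y≤x ⊥ᴬ y) (has⊥ J)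
    ; ∨-closed = λ hx hx' y y∈I →
        down J (reflexive (∧-distribʳ-∨ y _ _)) (∨-closed J (hx y y∈I) (hx' y y∈I))
    }

  Compact : Ideal → Set (suc ℓ)
  Compact I = ∀ (Ix : Set ℓ) (S : Ix → Ideal) → I ⊆ ⋁ S →
              Σ (List Ix) (λ T → I ⊆ ⋁fin (map S T))

  -- J(A) is a Heyting frame: K(J(A)) contains 0 and 1 and is closed under
  -- binary meets, binary joins and the Heyting implication of J(A).
  record IsHeytingFrame : Set (suc ℓ) where
    field
      compact-⊥ : Compact ⊥I
      compact-⊤ : Compact ⊤I
      compact-∩ : ∀ I J → Compact I → Compact J → Compact (I ∩ J)
      compact-⊔ : ∀ I J → Compact I → Compact J → Compact (I ⊔I J)
      compact-⇒ : ∀ I J → Compact I → Compact J → Compact (I ⇒I J)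

IdealFrameIsHeyting : ∀ {c ℓ₁ ℓ₂} → BoundedDistributiveLattice c ℓ₁ ℓ₂ → Set (suc (c ⊔ ℓ₂))
IdealFrameIsHeyting A = IdealFrame.IsHeytingFrame A

{-# OPTIONS --safe #-}
module Submission where

-- The compact elements of J(A) are exactly the principal ideals ↓a: a compact
-- ideal is covered by the principal ideals of its elements, hence by finitely
-- many of them, and is then generated by their join; conversely an ideal
-- covered by a join of ideals has its generator below finitely many members.
-- Since ↓a ∩ ↓b = ↓(a ∧ b), ↓a ⊔ ↓b = ↓(a ∨ b) and ↓x ⇒ ↓y = ↓(x ⇨ y) whenever
-- x ⇨ y exists, K(J(A)) is closed under the frame operations when A is Heyting;
-- conversely, if ↓x ⇒ ↓y is compact then its generator is the implication x ⇨ y.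

open import Defs
open import Level using (Lift; lift; lower)
open import Data.Product using (_×_; Σ; _,_; proj₁; proj₂)
open import Data.List using ([]; _∷_; map)
open import Data.Bool using (true; false)
open import Function using (_∘_)
open import Relation.Binary.Lattice.Definitions using (Exponential)
import Relation.Binary.Lattice.Properties.MeetSemilattice as MSP

module _ {c ℓ₁ ℓ₂} (A : BoundedDistributiveLattice c ℓ₁ ℓ₂) where
  open BoundedDistributiveLattice A
  open IdealFrame A
  open MSP meetSemilattice using (∧-monotonic)

  record IsPrincipal (I : Ideal) : Set ℓ where
    constructor principal
    field
      gen   : Carrier
      gen∈  : mem I gen
      ≤-gen : ∀ {x} → mem I x → x ≤ gen
  open IsPrincipal

  infix 25 ↓_
  ↓_ : Carrier → Ideal
  ↓ a = record
    { mem      = λ x → Lift ℓ (x ≤ a)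
    ; down     = λ { x≤y (lift y≤a) → lift (trans x≤y y≤a) }
    ; has⊥     = lift (minimum a)
    ; ∨-closed = λ { (lift p) (lift q) → lift (∨-least p q) }
    }

  ↓-isPrincipal : ∀ a → IsPrincipal (↓ a)
  ↓-isPrincipal a = principal a (lift refl) lower

  bigJoin-least : ∀ {X : Set ℓ} (f : X → Carrier) {b} →
                  (∀ z → f z ≤ b) → ∀ zs → bigJoin (map f zs) ≤ b
  bigJoin-least f f≤b []       = minimum _
  bigJoin-least f f≤b (z ∷ zs) = ∨-least (f≤b z) (bigJoin-least f f≤b zs)

  bigJoin-mem : ∀ I {X : Set ℓ} (f : X → Carrier) →
                (∀ z → mem I (f z)) → ∀ zs → mem I (bigJoin (map f zs))
  bigJoin-mem I f f∈I []       = has⊥ I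
  bigJoin-mem I f f∈I (z ∷ zs) = ∨-closed I (f∈I z) (bigJoin-mem I f f∈I zs)

  ⋁-upper : ∀ {Ix : Set ℓ} (S : Ix → Ideal) i → S i ⊆ ⋁ S
  ⋁-upper S i {x} x∈ = (i , x , x∈) ∷ [] , x≤x∨y x ⊥ᴬ

  ⊔I-upperˡ : ∀ I J → I ⊆ I ⊔I J
  ⊔I-upperˡ I J {x} x∈ = (lift true , x , x∈) ∷ [] , x≤x∨y x ⊥ᴬ

  ⊔I-upperʳ : ∀ I J → J ⊆ I ⊔I J
  ⊔I-upperʳ I J {x} x∈ = (lift false , x , x∈) ∷ [] , x≤x∨y x ⊥ᴬ

  ⊔I-least : ∀ I J {b} → (∀ {x} → mem I x → x ≤ b) → (∀ {x} → mem J x → x ≤ b) →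
             ∀ {x} → mem (I ⊔I J) x → x ≤ b
  ⊔I-least I J I≤b J≤b (ys , x≤) =
    trans x≤ (bigJoin-least _ (λ { (lift true , y∈) → I≤b (proj₂ y∈)
                                 ; (lift false , y∈) → J≤b (proj₂ y∈) }) ys)

  isPrincipal⇒compact : ∀ {I} → IsPrincipal I → Compact I
  isPrincipal⇒compact (principal a a∈ ≤a) Ix S I⊆⋁S with I⊆⋁S a∈
  ... | ys , a≤ = map proj₁ ys ,
                  λ x∈ → down (⋁fin (map S (map proj₁ ys))) (trans (≤a x∈) a≤) (covered ys)
    where
      covered : ∀ ys → mem (⋁fin (map S (map proj₁ ys))) (bigJoin (map (proj₁ ∘ proj₂) ys))
      covered []                 = lift refl
      covered ((i , y , y∈) ∷ ys) =
        ∨-closed (S i ⊔I _) (⊔I-upperˡ (S i) _ y∈) (⊔I-upperʳ (S i) _ (covered ys))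

  ⋁fin-↓-bounded : ∀ {X : Set ℓ} (f : X → Carrier) ts {x} →
                   mem (⋁fin (map (↓_ ∘ f) ts)) x → x ≤ bigJoin (map f ts)
  ⋁fin-↓-bounded f []       (lift x≤⊥) = x≤⊥
  ⋁fin-↓-bounded f (t ∷ ts) x∈         =
    ⊔I-least (↓ f t) _ (λ x≤t → trans (lower x≤t) (x≤x∨y _ _))
                       (λ x∈ts → trans (⋁fin-↓-bounded f ts x∈ts) (y≤x∨y _ _)) x∈

  compact⇒isPrincipal : ∀ {I} → Compact I → IsPrincipal I
  compact⇒isPrincipal {I} cI with cI (Σ Carrier (mem I)) (↓_ ∘ proj₁) covered
    where
      covered : I ⊆ ⋁ (↓_ ∘ proj₁)
      covered x∈ = ⋁-upper (↓_ ∘ proj₁) (_ , x∈) (lift refl)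
  ... | T , I⊆ = principal (bigJoin (map proj₁ T))
                           (bigJoin-mem I proj₁ proj₂ T)
                           (⋁fin-↓-bounded proj₁ T ∘ I⊆)

  ⊥I-isPrincipal : IsPrincipal ⊥I
  ⊥I-isPrincipal = principal ⊥ᴬ (lift refl) lower

  ⊤I-isPrincipal : IsPrincipal ⊤I
  ⊤I-isPrincipal = principal ⊤ᴬ _ (λ {x} _ → maximum x)

  ∩-isPrincipal : ∀ {I J} → IsPrincipal I → IsPrincipal J → IsPrincipal (I ∩ J)
  ∩-isPrincipal {I} {J} (principal a a∈ ≤a) (principal b b∈ ≤b) =
    principal (a ∧ b) (down I (x∧y≤x a b) a∈ , down J (x∧y≤y a b) b∈)
              (λ { (x∈I , x∈J) → ∧-greatest (≤a x∈I) (≤b x∈J) })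

  ⊔I-isPrincipal : ∀ {I J} → IsPrincipal I → IsPrincipal J → IsPrincipal (I ⊔I J)
  ⊔I-isPrincipal {I} {J} (principal a a∈ ≤a) (principal b b∈ ≤b) =
    principal (a ∨ b) (∨-closed (I ⊔I J) (⊔I-upperˡ I J a∈) (⊔I-upperʳ I J b∈))
              (⊔I-least I J (λ x∈I → trans (≤a x∈I) (x≤x∨y a b))
                            (λ x∈J → trans (≤b x∈J) (y≤x∨y a b)))

  ⇒I-isPrincipal : ∀ {_⇨_} → Exponential _≤_ _∧_ _⇨_ →
                   ∀ {I J} → IsPrincipal I → IsPrincipal J → IsPrincipal (I ⇒I J)
  ⇒I-isPrincipal {_⇨_} exp {I} {J} (principal a a∈ ≤a) (principal b b∈ ≤b) =
    principal (a ⇨ b)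
      (λ y y∈I → down J (trans (∧-monotonic refl (≤a y∈I)) (proj₂ (exp (a ⇨ b) a b) refl)) b∈)
      (λ {x} x⇒ → proj₁ (exp x a b) (≤b (x⇒ a a∈)))

  ↓⇒I↓-gen-exponential : (p : ∀ x y → IsPrincipal (↓ x ⇒I ↓ y)) →
                         Exponential _≤_ _∧_ (λ x y → gen (p x y))
  ↓⇒I↓-gen-exponential p w x y =
    (λ w∧x≤y → ≤-gen (p x y) (λ z z≤x → lift (trans (∧-monotonic refl (lower z≤x)) w∧x≤y))) ,
    (λ w≤gen → trans (∧-monotonic w≤gen refl) (lower (gen∈ (p x y) x (lift refl))))

  principal-closed⇒compact-closed : ∀ {_∙_ : Ideal → Ideal → Ideal} →
    (∀ {I J} → IsPrincipal I → IsPrincipal J → IsPrincipal (I ∙ J)) →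
    ∀ I J → Compact I → Compact J → Compact (I ∙ J)
  principal-closed⇒compact-closed ∙-closed I J cI cJ =
    isPrincipal⇒compact (∙-closed (compact⇒isPrincipal cI) (compact⇒isPrincipal cJ))

  heyting⇒idealFrameHeyting : IsHeytingAlgebra A → IdealFrameIsHeyting A
  heyting⇒idealFrameHeyting (_ , exp) = record
    { compact-⊥ = isPrincipal⇒compact ⊥I-isPrincipal
    ; compact-⊤ = isPrincipal⇒compact ⊤I-isPrincipal
    ; compact-∩ = principal-closed⇒compact-closed ∩-isPrincipal
    ; compact-⊔ = principal-closed⇒compact-closed ⊔I-isPrincipal
    ; compact-⇒ = principal-closed⇒compact-closed (⇒I-isPrincipal exp)
    }

  idealFrameHeyting⇒heyting : IdealFrameIsHeyting A → IsHeytingAlgebra A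
  idealFrameHeyting⇒heyting H = _ , ↓⇒I↓-gen-exponential ↓⇒I↓-isPrincipal
    where
      ↓⇒I↓-isPrincipal : ∀ x y → IsPrincipal (↓ x ⇒I ↓ y)
      ↓⇒I↓-isPrincipal x y = compact⇒isPrincipal
        (IsHeytingFrame.compact-⇒ H (↓ x) (↓ y)
          (isPrincipal⇒compact (↓-isPrincipal x)) (isPrincipal⇒compact (↓-isPrincipal y)))

corollary3p3 : ∀ {c ℓ₁ ℓ₂} (A : BoundedDistributiveLattice c ℓ₁ ℓ₂) →
    (IsHeytingAlgebra A → IdealFrameIsHeyting A) × (IdealFrameIsHeyting A → IsHeytingAlgebra A)
corollary3p3 A = heyting⇒idealFrameHeyting A , idealFrameHeyting⇒heyting A
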